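{- Let $G$ be a finite simple bipartite graph of order $2n$ with a perfect matching. Then $$f(G)\geq n-\frac{1}{2}-\sqrt{2n^2-2e(G)+\frac{1}{4}},$$ and equality holds if and only if $G$ is isomorphic to $H_{n,k}$ for some integer $0\leq k\leq n-1$.
   Context: For a graph $G$ with a perfect matching $M$, a subset $S\subseteq M$ is a forcing set of $M$ if $S$ is contained in no perfect matching of $G$ other than $M$. $f(G,M)$ is the minimum size of a forcing set of $M$, and $f(G)=\min_M f(G,M)$ over all perfect matchings $M$. $e(G)$ is the number of edges. For integers $0\leq k\leq n-1$, $H_{n,k}$ is the bipartite graph with parts $U=\{u_1,\dots,u_n\}$ and $V=\{v_1,\dots,v_n\}$ in which $u_iv_j$ is a non-edge if and only if $1\leq i<j\leq n-k$ (all other pairs $u_iv_j$ are edges). -}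

module Defs where

open import Data.Bool using (Bool; true; false; not; _∧_; if_then_else_)
open import Data.Nat using (ℕ; _∸_; _<ᵇ_) renaming (_*_ to _*ℕ_)
open import Data.Fin using (Fin; toℕ)
open import Data.Fin.Subset using (Subset; _∈_; ∣_∣)
open import Data.List using (tabulate)
open import Data.Nat.ListAction using (sum)
open import Data.Sum using (_⊎_; inj₁; inj₂)
open import Data.Product using (Σ; _×_; ∃; ∃-syntax; _,_)
open import Data.Integer using (ℤ; +_; _+_; _-_; _*_; _≤_)
open import Function.Bundles using (_↔_; Inverse)
open import Function.Definitions using (Injective)
open import Relation.Binary.PropositionalEquality using (_≡_)

-- A finite simple bipartite graph of order 2n whose two colour classes
-- U = {u_0..u_{n-1}} and V = {v_0..v_{n-1}} both have n vertices
-- (forced for any bipartite graph of order 2n with a perfect matching).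
-- G i j = true  iff  u_i v_j is an edge.
BipGraph : ℕ → Set
BipGraph n = Fin n → Fin n → Bool

-- Vertex set of the underlying graph: inj₁ i = u_i, inj₂ j = v_j.
Vtx : ℕ → Set
Vtx n = Fin n ⊎ Fin n

Adj : ∀ {n} → BipGraph n → Vtx n → Vtx n → Bool
Adj G (inj₁ i) (inj₂ j) = G i j
Adj G (inj₂ j) (inj₁ i) = G i j
Adj G (inj₁ _) (inj₁ _) = false
Adj G (inj₂ _) (inj₂ _) = false

-- Graph isomorphism of the underlying graphs (may swap sides).
_≅_ : ∀ {n} → BipGraph n → BipGraph n → Set
_≅_ {n} G H = Σ (Vtx n ↔ Vtx n) λ φ →
  ∀ x y → Adj G x y ≡ Adj H (Inverse.to φ x) (Inverse.to φ y)

e : ∀ {n} → BipGraph n → ℕ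
e {n} G = sum (tabulate {n = n} λ i → sum (tabulate {n = n} λ j → if G i j then 1 else 0))

-- A perfect matching M = {u_i v_{m i}} : an injective (hence bijective)
-- map m : Fin n → Fin n with every u_i v_{m i} an edge.
PerfectMatching : ∀ {n} → BipGraph n → Set
PerfectMatching {n} G = Σ (Fin n → Fin n) λ m → Injective _≡_ _≡_ m × (∀ i → G i (m i) ≡ true)

-- S ⊆ M, encoded by the set of indices i such that u_i v_{m i} ∈ S.
-- S is a forcing set of M if every perfect matching containing S equals M.
IsForcingSet : ∀ {n} (G : BipGraph n) → PerfectMatching G → Subset n → Set
IsForcingSet {n} G (m , _) S =
  (M' : PerfectMatching G) → let m' = Data.Product.proj₁ M' in
    (∀ i → i ∈ S → m' i ≡ m i) → ∀ i → m' i ≡ m i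
  where import Data.Product

IsForcingNumber : ∀ {n} → BipGraph n → ℕ → Set
IsForcingNumber {n} G k =
  (Σ (PerfectMatching G) λ M → Σ (Subset n) λ S → IsForcingSet G M S × ∣ S ∣ ≡ k)
  × (∀ (M : PerfectMatching G) (S : Subset n) → IsForcingSet G M S → k Data.Nat.≤ ∣ S ∣)
  where import Data.Nat

-- H_{n,k}: u_i v_j (1-indexed) is a non-edge iff 1 ≤ i < j ≤ n-k.
-- With 0-indexed i, j: non-edge iff i < j and j < n ∸ k.
H : (n k : ℕ) → BipGraph n
H n k i j = not ((toℕ i <ᵇ toℕ j) ∧ (toℕ j <ᵇ (n ∸ k)))

-- Real-number comparisons with square roots, over ℤ:
-- a ≤ √D   (with √D defined, i.e. D ≥ 0)
_≤√_ : ℤ → ℤ → Set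
a ≤√ D = (+ 0 ≤ D) × (a ≤ + 0 ⊎ a * a ≤ D)

_≡√_ : ℤ → ℤ → Set
a ≡√ D = (+ 0 ≤ a) × (a * a ≡ D)

-- 2(n - 1/2 - f) = 2n - 1 - 2f,  and 4(2n² - 2e + 1/4) = 8n² - 8e + 1.
lhsScaled : ℕ → ℕ → ℤ
lhsScaled n f = + (2 *ℕ n) - + 1 - + (2 *ℕ f)

discScaled : ℕ → ℕ → ℤ
discScaled n e' = + (8 *ℕ (n *ℕ n)) - + (8 *ℕ e') + + 1

-- Relabel V along a perfect matching M so that M becomes the diagonal, and let T be the
-- t = n − f indices outside a minimum forcing set S. Since M is forced by S, no
-- M-alternating cycle lives inside T; in particular for distinct i, j ∈ T at most one
-- of u_i v_j, u_j v_i is an edge. Hence every ordered pair (i, j) contributes at most 2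
-- to [u_i v_j] + [u_j v_i] + [i ≠ j both in T], and summing gives
-- 2 e(G) + t (t − 1) + R = 2 n² with slack R ≥ 0, i.e.
-- 8 n² − 8 e(G) + 1 = (2 t − 1)² + 4 R with 2 t − 1 = 2 (n − 1/2 − f): the inequality.
-- Equality means R = 0. Then the rows and columns of S are full and non-adjacency is a
-- strict total order on T (transitive because alternating 3-cycles are excluded too),
-- and ranking the vertices, T first, exhibits G ≅ H n f. Conversely, the last k diagonal
-- edges force the identity matching of H n k, and 2 e(H n k) + (n − k)(n − k − 1) = 2 n²;
-- since f ≤ k, comparing with G again gives R = 0.

module Submission where

open import Defs
open import Data.Nat using (ℕ; _<_; _∸_)
open import Data.Product using (Σ; _×_; ∃-syntax)
open import Function.Bundles using (_⇔_)

import Algebra.Properties.CommutativeMonoid.Sum as Sum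
open import Data.Bool using (Bool; true; false; not; _∧_; _∨_; if_then_else_)
open import Data.Bool.Properties using (T-≡; ∧-zeroʳ; ∧-identityʳ)
open import Data.Empty using (⊥)
open import Data.Fin as Fin using (Fin; toℕ; fromℕ<; _≟_)
import Data.Fin.Properties as Fin
open import Data.Fin.Permutation as Perm using (Permutation′; _⟨$⟩ʳ_; _⟨$⟩ˡ_; _∘ₚ_)
import Data.Fin.Permutation.Components as PC
open import Data.Fin.Subset using (Subset; ∣_∣; _∈_)
import Data.List as List using (tabulate)
open import Data.Nat using (zero; suc; pred; _+_; _*_; _≤_; _<ᵇ_; _<?_; z≤n; s≤s)
import Data.Nat.ListAction as ListAction
open import Data.Nat.Properties hiding (_≟_)
open import Data.Product using (_,_; proj₁; proj₂)
open import Data.Sum using (_⊎_; inj₁; inj₂)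
open import Data.Sum.Function.Propositional using (_⊎-↔_)
open import Data.Sum.Properties using (inj₁-injective; inj₂-injective)
open import Data.Vec as Vec using (_∷_; [])
import Data.Vec.Properties as Vec
open import Function.Base using (_∘_; _⟨_⟩_; id)
open import Function.Bundles using (Equivalence; Inverse; mk⇔)
open import Function.Definitions using (Injective)
open import Relation.Binary using (tri<; tri≈; tri>)
open import Relation.Binary.PropositionalEquality
open import Relation.Nullary using (Dec; does; yes; no)
open import Relation.Nullary.Negation using (contradiction)
open import Relation.Nullary.Reflects using (ofʸ; ofⁿ)

open Sum +-0-commutativeMonoid using (sum; sum-cong-≗; ∑-distrib-+; ∑-comm; sum-permute)

⟦_⟧ : Bool → ℕ
⟦ b ⟧ = if b then 1 else 0

⟦⟧≤1 : ∀ b → ⟦ b ⟧ ≤ 1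
⟦⟧≤1 true = s≤s z≤n
⟦⟧≤1 false = z≤n

count : ∀ {n} → (Fin n → Bool) → ℕ
count p = sum (⟦_⟧ ∘ p)

sum-const : ∀ n c → sum {n} (λ _ → c) ≡ n * c
sum-const zero c = refl
sum-const (suc n) c = cong (c +_) (sum-const n c)

sum-*ʳ : ∀ {n} (f : Fin n → ℕ) c → sum (λ i → f i * c) ≡ sum f * c
sum-*ʳ {zero} f c = refl
sum-*ʳ {suc n} f c = trans (cong (f Fin.zero * c +_) (sum-*ʳ (f ∘ Fin.suc) c)) (sym (*-distribʳ-+ c (f Fin.zero) _))

sum-mono-≤ : ∀ {n} {f g : Fin n → ℕ} → (∀ i → f i ≤ g i) → sum f ≤ sum g
sum-mono-≤ {zero} f≤g = z≤n
sum-mono-≤ {suc n} f≤g = +-mono-≤ (f≤g Fin.zero) (sum-mono-≤ (f≤g ∘ Fin.suc))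

sum-mono-< : ∀ {n} {f g : Fin n → ℕ} → (∀ i → f i ≤ g i) → ∀ j → f j < g j → sum f < sum g
sum-mono-< {suc n} f≤g Fin.zero fj<gj = +-mono-<-≤ fj<gj (sum-mono-≤ (f≤g ∘ Fin.suc))
sum-mono-< {suc n} f≤g (Fin.suc j) fj<gj = +-mono-≤-< (f≤g Fin.zero) (sum-mono-< (f≤g ∘ Fin.suc) j fj<gj)

sum-≥⇒pointwise-≡ : ∀ {n} {f g : Fin n → ℕ} → (∀ i → f i ≤ g i) → sum g ≤ sum f → ∀ i → f i ≡ g i
sum-≥⇒pointwise-≡ f≤g ∑g≤∑f i with m≤n⇒m<n∨m≡n (f≤g i)
... | inj₁ fi<gi = contradiction ∑g≤∑f (<⇒≱ (sum-mono-< f≤g i fi<gi))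
... | inj₂ fi≡gi = fi≡gi

count-complement : ∀ {n} (p : Fin n → Bool) → count p + count (not ∘ p) ≡ n
count-complement {n} p = begin
  count p + count (not ∘ p)           ≡⟨ ∑-distrib-+ (⟦_⟧ ∘ p) (⟦_⟧ ∘ not ∘ p) ⟨
  sum (λ i → ⟦ p i ⟧ + ⟦ not (p i) ⟧) ≡⟨ sum-cong-≗ (λ i → ⟦b⟧+⟦not-b⟧≡1 (p i)) ⟩
  sum {n} (λ _ → 1)                   ≡⟨ sum-const n 1 ⟩
  n * 1                               ≡⟨ *-identityʳ n ⟩
  n                                   ∎
  where
  open ≡-Reasoning
  ⟦b⟧+⟦not-b⟧≡1 : ∀ b → ⟦ b ⟧ + ⟦ not b ⟧ ≡ 1
  ⟦b⟧+⟦not-b⟧≡1 true = refl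
  ⟦b⟧+⟦not-b⟧≡1 false = refl

count-<ᵇ : ∀ {n} c → c ≤ n → count {n} (λ i → toℕ i <ᵇ c) ≡ c
count-<ᵇ {n} zero _ = trans (sum-const n 0) (*-zeroʳ n)
count-<ᵇ {suc n} (suc c) (s≤s c≤n) = cong suc (count-<ᵇ c c≤n)

∣∣≡count : ∀ {n} (S : Subset n) → ∣ S ∣ ≡ count (Vec.lookup S)
∣∣≡count [] = refl
∣∣≡count (true ∷ S) = cong suc (∣∣≡count S)
∣∣≡count (false ∷ S) = ∣∣≡count S

sum-δ : ∀ {n} (i : Fin n) c → sum (λ j → if does (i ≟ j) then c else 0) ≡ c
sum-δ {suc n} Fin.zero c = cong (c +_) (trans (sum-const n 0) (*-zeroʳ n)) ⟨ trans ⟩ +-identityʳ c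
sum-δ {suc n} (Fin.suc i) c = sum-δ i c

distinctPairs : ∀ {n} → (Fin n → Bool) → ℕ
distinctPairs p = sum λ x → sum λ y → ⟦ p x ∧ (p y ∧ not (does (x ≟ y))) ⟧

distinctPairs+count : ∀ {n} (p : Fin n → Bool) → distinctPairs p + count p ≡ count p * count p
distinctPairs+count p = begin
  distinctPairs p + count p                              ≡⟨ ∑-distrib-+ (λ x → sum (pair x)) (⟦_⟧ ∘ p) ⟨
  sum (λ x → sum (pair x) + ⟦ p x ⟧)                     ≡⟨ sum-cong-≗ row ⟩
  sum (λ x → ⟦ p x ⟧ * count p)                          ≡⟨ sum-*ʳ (⟦_⟧ ∘ p) (count p) ⟩
  count p * count p                                      ∎
  where
  open ≡-Reasoning
  pair : _ → _ → ℕ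
  pair x y = ⟦ p x ∧ (p y ∧ not (does (x ≟ y))) ⟧
  δ : _ → _ → ℕ
  δ x y = if does (x ≟ y) then ⟦ p x ⟧ else 0
  entry : ∀ x y → pair x y + δ x y ≡ ⟦ p x ⟧ * ⟦ p y ⟧
  entry x y with x ≟ y
  entry x .x | yes refl with p x
  ... | true = refl
  ... | false = refl
  entry x y | no _ with p x | p y
  ... | true | true = refl
  ... | true | false = refl
  ... | false | _ = refl
  row : ∀ x → sum (pair x) + ⟦ p x ⟧ ≡ ⟦ p x ⟧ * count p
  row x = begin
    sum (pair x) + ⟦ p x ⟧                  ≡⟨ cong (sum (pair x) +_) (sum-δ x ⟦ p x ⟧) ⟨
    sum (pair x) + sum (δ x)                ≡⟨ ∑-distrib-+ (pair x) (δ x) ⟨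
    sum (λ y → pair x y + δ x y)            ≡⟨ sum-cong-≗ (entry x) ⟩
    sum (λ y → ⟦ p x ⟧ * ⟦ p y ⟧)           ≡⟨ sum-cong-≗ (λ y → *-comm ⟦ p x ⟧ ⟦ p y ⟧) ⟩
    sum (λ y → ⟦ p y ⟧ * ⟦ p x ⟧)           ≡⟨ sum-*ʳ (⟦_⟧ ∘ p) ⟦ p x ⟧ ⟩
    count p * ⟦ p x ⟧                       ≡⟨ *-comm (count p) ⟦ p x ⟧ ⟩
    ⟦ p x ⟧ * count p                       ∎

distinctPairs-mono : ∀ {n} (p q : Fin n → Bool) → count p ≤ count q → distinctPairs p ≤ distinctPairs q
distinctPairs-mono p q cp≤cq = subst₂ _≤_ (closed-form p) (closed-form q) (*-mono-≤ cp≤cq (pred-mono-≤ cp≤cq))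
  where
  *pred+ : ∀ t → t * pred t + t ≡ t * t
  *pred+ zero = refl
  *pred+ (suc t) = trans (+-comm (suc t * t) (suc t)) (sym (*-suc (suc t) t))
  closed-form : ∀ p → count p * pred (count p) ≡ distinctPairs p
  closed-form p = +-cancelʳ-≡ (count p) _ _ (trans (*pred+ (count p)) (sym (distinctPairs+count p)))

<ᵇ-true : ∀ {a b} → a < b → (a <ᵇ b) ≡ true
<ᵇ-true a<b = T-≡ .Equivalence.to (<⇒<ᵇ a<b)

<ᵇ-false : ∀ {a b} → b ≤ a → (a <ᵇ b) ≡ false
<ᵇ-false {a} {b} b≤a with a <ᵇ b | <ᵇ-reflects-< a b
... | false | _ = refl
... | true | ofʸ a<b = contradiction b≤a (<⇒≱ a<b)

<ᵇ-true⁻¹ : ∀ {a b} → (a <ᵇ b) ≡ true → a < b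
<ᵇ-true⁻¹ {a} {b} eq = <ᵇ⇒< a b (T-≡ .Equivalence.from eq)

<ᵇ-false⁻¹ : ∀ {a b} → (a <ᵇ b) ≡ false → b ≤ a
<ᵇ-false⁻¹ {a} {b} eq with a <ᵇ b | <ᵇ-reflects-< a b
... | false | ofⁿ a≮b = ≮⇒≥ a≮b

pred<self : ∀ {a t} → a < t → pred t < t
pred<self (s≤s _) = ≤-refl

sum-tabulate : ∀ {n} (f : Fin n → ℕ) → ListAction.sum (List.tabulate f) ≡ sum f
sum-tabulate {zero} f = refl
sum-tabulate {suc n} f = cong (f Fin.zero +_) (sum-tabulate (f ∘ Fin.suc))

e≡∑∑ : ∀ {n} (G : BipGraph n) → e G ≡ sum λ i → sum λ j → ⟦ G i j ⟧
e≡∑∑ {n} G = trans (sum-tabulate {n} _) (sum-cong-≗ λ i → sum-tabulate {n} λ j → ⟦ G i j ⟧)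

sum-∘-permutation : ∀ {n} (f : Fin n → ℕ) (π : Permutation′ n) → sum (λ i → f (π ⟨$⟩ʳ i)) ≡ sum f
sum-∘-permutation f π = sym (sum-permute f π)

⟨$⟩ʳ-injective : ∀ {n} (π : Permutation′ n) → Injective _≡_ _≡_ (π ⟨$⟩ʳ_)
⟨$⟩ʳ-injective π {i} {j} πi≡πj = sym (Perm.inverseˡ π) ⟨ trans ⟩ cong (π ⟨$⟩ˡ_) πi≡πj ⟨ trans ⟩ Perm.inverseˡ π

injective⇒surjective : ∀ {n} (f : Fin n → Fin n) → Injective _≡_ _≡_ f → ∀ y → Σ (Fin n) λ x → f x ≡ y
injective⇒surjective {suc n} f f-inj y with Fin.any? (λ x → f x ≟ y)
... | yes hit = hit
... | no miss = contradiction (Fin.injective⇒≤ f′-inj) (<-irrefl refl)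
  where
  f′ : Fin (suc n) → Fin n
  f′ x = Fin.punchOut {i = y} {j = f x} (λ y≡fx → miss (x , sym y≡fx))
  f′-inj : Injective _≡_ _≡_ f′
  f′-inj {a} {b} = f-inj ∘ Fin.punchOut-injective (λ y≡fa → miss (a , sym y≡fa)) (λ y≡fb → miss (b , sym y≡fb))

injective⇒permutation : ∀ {n} (f : Fin n → Fin n) → Injective _≡_ _≡_ f → Permutation′ n
injective⇒permutation f f-inj = Perm.permutation f (proj₁ ∘ surj) (proj₂ ∘ surj) (λ x → f-inj (proj₂ (surj (f x))))
  where surj = injective⇒surjective f f-inj

infix 4 _≃_
record _≃_ {n} (G G′ : BipGraph n) : Set where
  constructor mk≃
  field
    rows columns : Permutation′ n
    relabel : ∀ i j → G i j ≡ G′ (rows ⟨$⟩ʳ i) (columns ⟨$⟩ʳ j)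

≃-trans : ∀ {n} {G G′ G″ : BipGraph n} → G ≃ G′ → G′ ≃ G″ → G ≃ G″
≃-trans (mk≃ α β G≡G′) (mk≃ α′ β′ G′≡G″) = mk≃ (α ∘ₚ α′) (β ∘ₚ β′) λ i j → trans (G≡G′ i j) (G′≡G″ _ _)

≃⇒≅ : ∀ {n} {G G′ : BipGraph n} → G ≃ G′ → G ≅ G′
≃⇒≅ (mk≃ α β G≡G′) = (α ⊎-↔ β) , adj
  where
  adj : ∀ x y → _
  adj (inj₁ i) (inj₁ i′) = refl
  adj (inj₁ i) (inj₂ j) = G≡G′ i j
  adj (inj₂ j) (inj₁ i) = G≡G′ i j
  adj (inj₂ j) (inj₂ j′) = refl

≃-edges : ∀ {n} {G G′ : BipGraph n} → G ≃ G′ → e G ≡ e G′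
≃-edges {G = G} {G′} (mk≃ α β G≡G′) = begin
  e G                                                 ≡⟨ e≡∑∑ G ⟩
  sum (λ i → sum λ j → ⟦ G i j ⟧)
    ≡⟨ sum-cong-≗ (λ i → sum-cong-≗ λ j → cong ⟦_⟧ (G≡G′ i j)) ⟩
  sum (λ i → sum λ j → ⟦ G′ (α ⟨$⟩ʳ i) (β ⟨$⟩ʳ j) ⟧)
    ≡⟨ sum-cong-≗ (λ i → sum-∘-permutation (λ b → ⟦ G′ (α ⟨$⟩ʳ i) b ⟧) β) ⟩
  sum (λ i → sum λ b → ⟦ G′ (α ⟨$⟩ʳ i) b ⟧)           ≡⟨ sum-∘-permutation (λ a → sum λ b → ⟦ G′ a b ⟧) α ⟩
  sum (λ a → sum λ b → ⟦ G′ a b ⟧)                    ≡⟨ e≡∑∑ G′ ⟨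
  e G′                                                ∎
  where open ≡-Reasoning

_ᵀ : ∀ {n} → BipGraph n → BipGraph n
(G ᵀ) i j = G j i

≃-sym : ∀ {n} {G G′ : BipGraph n} → G ≃ G′ → G′ ≃ G
≃-sym {G = G} {G′} (mk≃ α β G≡G′) = mk≃ (Perm.flip α) (Perm.flip β) λ a b →
  cong₂ G′ (sym (Perm.inverseʳ α)) (sym (Perm.inverseʳ β)) ⟨ trans ⟩ sym (G≡G′ _ _)

≃-transpose : ∀ {n} {G G′ : BipGraph n} → G ≃ G′ → G ᵀ ≃ G′ ᵀ
≃-transpose (mk≃ α β G≡G′) = mk≃ β α λ i j → G≡G′ j i

HasForcingSetOfSize : ∀ {n} → BipGraph n → ℕ → Set
HasForcingSetOfSize {n} G k = Σ (PerfectMatching G) λ M → Σ (Subset n) λ S → IsForcingSet G M S × ∣ S ∣ ≡ k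

forcingNumber≤ : ∀ {n f k} {G : BipGraph n} → (∀ M S → IsForcingSet G M S → f ≤ ∣ S ∣) →
  HasForcingSetOfSize G k → f ≤ k
forcingNumber≤ {f = f} minimal (M , S , S-forces , ∣S∣≡k) = subst (f ≤_) ∣S∣≡k (minimal M S S-forces)

≃-forcingSet : ∀ {n k} {G G′ : BipGraph n} → G ≃ G′ → HasForcingSetOfSize G′ k → HasForcingSetOfSize G k
≃-forcingSet {n} {k} {G} {G′} (mk≃ α β G≡G′) ((m′ , m′-inj , m′-edge) , S′ , S′-forces , ∣S′∣≡k) =
  (m , m-inj , m-edge) , S , S-forces , ∣S∣≡k
  where
  m : Fin n → Fin n
  m i = β ⟨$⟩ˡ m′ (α ⟨$⟩ʳ i)
  m-inj : Injective _≡_ _≡_ m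
  m-inj = ⟨$⟩ʳ-injective α ∘ m′-inj ∘ ⟨$⟩ʳ-injective (Perm.flip β)
  m-edge : ∀ i → G i (m i) ≡ true
  m-edge i = G≡G′ i (m i) ⟨ trans ⟩ cong (G′ (α ⟨$⟩ʳ i)) (Perm.inverseʳ β) ⟨ trans ⟩ m′-edge (α ⟨$⟩ʳ i)
  s : Fin n → Bool
  s i = Vec.lookup S′ (α ⟨$⟩ʳ i)
  S : Subset n
  S = Vec.tabulate s
  ∣S∣≡k : ∣ S ∣ ≡ k
  ∣S∣≡k = ∣∣≡count S
    ⟨ trans ⟩ sum-cong-≗ (λ i → cong ⟦_⟧ (Vec.lookup∘tabulate s i))
    ⟨ trans ⟩ sum-∘-permutation (⟦_⟧ ∘ Vec.lookup S′) α
    ⟨ trans ⟩ sym (∣∣≡count S′) ⟨ trans ⟩ ∣S′∣≡k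
  S-forces : IsForcingSet G (m , m-inj , m-edge) S
  S-forces (m₁ , m₁-inj , m₁-edge) agree i =
    sym (Perm.inverseˡ β) ⟨ trans ⟩ cong (β ⟨$⟩ˡ_) (cong (λ x → β ⟨$⟩ʳ m₁ x) (sym (Perm.inverseˡ α))
      ⟨ trans ⟩ S′-forces (m₁′ , m₁′-inj , m₁′-edge) agree′ (α ⟨$⟩ʳ i))
    where
    m₁′ : Fin n → Fin n
    m₁′ a = β ⟨$⟩ʳ m₁ (α ⟨$⟩ˡ a)
    m₁′-inj : Injective _≡_ _≡_ m₁′
    m₁′-inj = ⟨$⟩ʳ-injective (Perm.flip α) ∘ m₁-inj ∘ ⟨$⟩ʳ-injective β
    m₁′-edge : ∀ a → G′ a (m₁′ a) ≡ true
    m₁′-edge a = cong (λ x → G′ x (m₁′ a)) (sym (Perm.inverseʳ α)) ⟨ trans ⟩ sym (G≡G′ _ _) ⟨ trans ⟩ m₁-edge (α ⟨$⟩ˡ a)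
    agree′ : ∀ a → a ∈ S′ → m₁′ a ≡ m′ a
    agree′ a a∈S′ = cong (β ⟨$⟩ʳ_) (agree (α ⟨$⟩ˡ a) (Vec.lookup⇒[]= _ S lookupS))
      ⟨ trans ⟩ Perm.inverseʳ β ⟨ trans ⟩ cong m′ (Perm.inverseʳ α)
      where
      lookupS : Vec.lookup S (α ⟨$⟩ˡ a) ≡ true
      lookupS = Vec.lookup∘tabulate s _ ⟨ trans ⟩ cong (Vec.lookup S′) (Perm.inverseʳ α) ⟨ trans ⟩ Vec.[]=⇒lookup a∈S′

matchingFrame : ∀ {n} (G : BipGraph n) → PerfectMatching G → BipGraph n
matchingFrame G (m , _) i j = G i (m j)

≃-matchingFrame : ∀ {n} (G : BipGraph n) (M : PerfectMatching G) → G ≃ matchingFrame G M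
≃-matchingFrame G (m , m-inj , _) = mk≃ Perm.id (Perm.flip μ) λ i j → cong (G i) (sym (Perm.inverseʳ μ))
  where μ = injective⇒permutation m m-inj

matchingFrame-diagonal : ∀ {n} (G : BipGraph n) (M : PerfectMatching G) → ∀ i → matchingFrame G M i i ≡ true
matchingFrame-diagonal G (_ , _ , m-edge) = m-edge

-- s forces the identity matching of G; perfect matchings are read as permutations τ (edges u_i v_(τ i)).
DiagonalForcedBy : ∀ {n} → BipGraph n → (Fin n → Bool) → Set
DiagonalForcedBy {n} G s = (τ : Permutation′ n) → (∀ i → G i (τ ⟨$⟩ʳ i) ≡ true) →
  (∀ i → s i ≡ true → τ ⟨$⟩ʳ i ≡ i) → ∀ i → τ ⟨$⟩ʳ i ≡ i

matchingFrame-forced : ∀ {n} (G : BipGraph n) (M : PerfectMatching G) (S : Subset n) →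
  IsForcingSet G M S → DiagonalForcedBy (matchingFrame G M) (Vec.lookup S)
matchingFrame-forced G (m , m-inj , m-edge) S S-forces τ τ-edge τ-fixes i =
  m-inj (S-forces (m ∘ (τ ⟨$⟩ʳ_) , ⟨$⟩ʳ-injective τ ∘ m-inj , τ-edge)
                  (λ j j∈S → cong m (τ-fixes j (Vec.[]=⇒lookup j∈S))) i)

module _ {n} (i j : Fin n) where

  transpose-i : PC.transpose i j i ≡ j
  transpose-i with i ≟ i
  ... | yes _ = refl
  ... | no i≢i = contradiction refl i≢i

  transpose-j : PC.transpose i j j ≡ i
  transpose-j with j ≟ i
  ... | yes j≡i = j≡i
  ... | no _ with j ≟ j
  ...   | yes _ = refl
  ...   | no j≢j = contradiction refl j≢j

  transpose-other : ∀ {k} → k ≢ i → k ≢ j → PC.transpose i j k ≡ k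
  transpose-other {k} k≢i k≢j with k ≟ i
  ... | yes k≡i = contradiction k≡i k≢i
  ... | no _ with k ≟ j
  ...   | yes k≡j = contradiction k≡j k≢j
  ...   | no _ = refl

pairWeight : ∀ {n} → BipGraph n → (Fin n → Bool) → Fin n → Fin n → ℕ
pairWeight G p x y = ⟦ G x y ⟧ + ⟦ G y x ⟧ + ⟦ p x ∧ (p y ∧ not (does (x ≟ y))) ⟧

sum-pairWeight : ∀ {n} (G : BipGraph n) (p : Fin n → Bool) →
  sum (λ x → sum λ y → pairWeight G p x y) ≡ e G + e G + distinctPairs p
sum-pairWeight G p = begin
  sum (λ x → sum λ y → A x y + A y x + D x y)
    ≡⟨ sum-cong-≗ (λ x → ∑-distrib-+ (λ y → A x y + A y x) (D x)) ⟩
  sum (λ x → sum (λ y → A x y + A y x) + sum (D x))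
    ≡⟨ ∑-distrib-+ (λ x → sum λ y → A x y + A y x) (sum ∘ D) ⟩
  sum (λ x → sum λ y → A x y + A y x) + distinctPairs p
    ≡⟨ cong (_+ distinctPairs p) (sum-cong-≗ λ x → ∑-distrib-+ (A x) (λ y → A y x)) ⟩
  sum (λ x → sum (A x) + sum (λ y → A y x)) + distinctPairs p
    ≡⟨ cong (_+ distinctPairs p) (∑-distrib-+ (sum ∘ A) (λ x → sum λ y → A y x)) ⟩
  ∑A + sum (λ x → sum λ y → A y x) + distinctPairs p
    ≡⟨ cong (λ c → ∑A + c + distinctPairs p) (∑-comm (λ y x → A y x)) ⟨
  ∑A + ∑A + distinctPairs p
    ≡⟨ cong (λ c → c + c + distinctPairs p) (e≡∑∑ G) ⟨
  e G + e G + distinctPairs p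
    ∎
  where
  open ≡-Reasoning
  A : _ → _ → ℕ
  A x y = ⟦ G x y ⟧
  D : _ → _ → ℕ
  D x y = ⟦ p x ∧ (p y ∧ not (does (x ≟ y))) ⟧
  ∑A = sum λ x → sum (A x)

pairWeight-tight : ∀ {n} (G : BipGraph n) (p : Fin n → Bool) → (∀ x y → pairWeight G p x y ≤ 2) →
  n * (n * 2) ≤ e G + e G + distinctPairs p → ∀ x y → pairWeight G p x y ≡ 2
pairWeight-tight {n} G p ≤2 ≥2n² x = sum-≥⇒pointwise-≡ (≤2 x) (≤-reflexive (sym (rows-full x)))
  where
  ∑2≡ : sum {n} (λ _ → sum {n} λ _ → 2) ≡ n * (n * 2)
  ∑2≡ = trans (sum-cong-≗ {n} λ _ → sum-const n 2) (sum-const n (n * 2))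
  rows-full : ∀ x → sum (pairWeight G p x) ≡ sum {n} (λ _ → 2)
  rows-full = sum-≥⇒pointwise-≡ (λ x → sum-mono-≤ (≤2 x))
    (≤-trans (≤-reflexive ∑2≡) (≤-trans ≥2n² (≤-reflexive (sym (sum-pairWeight G p)))))

module Ranking {n} (_≺_ : Fin n → Fin n → Bool)
  (≺-irrefl : ∀ x → (x ≺ x) ≡ false)
  (≺-trans : ∀ {x y z} → (x ≺ y) ≡ true → (y ≺ z) ≡ true → (x ≺ z) ≡ true)
  (≺-connex : ∀ {x y} → x ≢ y → (x ≺ y) ≡ false → (y ≺ x) ≡ true) where

  rank : Fin n → ℕ
  rank x = count (_≺ x)

  rank-mono : ∀ {x y} → (x ≺ y) ≡ true → rank x < rank y
  rank-mono {x} {y} x≺y = sum-mono-< below x (subst₂ (λ a b → ⟦ a ⟧ < ⟦ b ⟧) (sym (≺-irrefl x)) (sym x≺y) (s≤s z≤n))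
    where
    below : ∀ z → ⟦ z ≺ x ⟧ ≤ ⟦ z ≺ y ⟧
    below z with z ≺ x in z≺x
    ... | false = z≤n
    ... | true rewrite ≺-trans z≺x x≺y = ≤-refl

  rank-<ᵇ : ∀ x y → (rank x <ᵇ rank y) ≡ (x ≺ y)
  rank-<ᵇ x y with x ≺ y in x≺y
  ... | true = <ᵇ-true (rank-mono x≺y)
  ... | false with x ≟ y
  ...   | yes refl = <ᵇ-false (≤-refl {rank x})
  ...   | no x≢y = <ᵇ-false (<⇒≤ (rank-mono (≺-connex x≢y x≺y)))

  rank-injective : ∀ {x y} → rank x ≡ rank y → x ≡ y
  rank-injective {x} {y} rx≡ry with x ≟ y
  ... | yes x≡y = x≡y
  ... | no x≢y with x ≺ y in x≺y
  ...   | true = contradiction rx≡ry (<⇒≢ (rank-mono x≺y))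
  ...   | false = contradiction (sym rx≡ry) (<⇒≢ (rank-mono (≺-connex x≢y x≺y)))

  rank<n : ∀ x → rank x < n
  rank<n x = subst (rank x <_) (trans (sum-const n 1) (*-identityʳ n))
    (sum-mono-< (λ z → ⟦⟧≤1 (z ≺ x)) x (subst (λ b → ⟦ b ⟧ < 1) (sym (≺-irrefl x)) (s≤s z≤n)))

  rankPermutation : Permutation′ n
  rankPermutation = injective⇒permutation (λ x → fromℕ< (rank<n x))
    (λ eq → rank-injective (sym (Fin.toℕ-fromℕ< _) ⟨ trans ⟩ cong toℕ eq ⟨ trans ⟩ Fin.toℕ-fromℕ< _))

  toℕ-rankPermutation : ∀ x → toℕ (rankPermutation ⟨$⟩ʳ x) ≡ rank x
  toℕ-rankPermutation x = Fin.toℕ-fromℕ< (rank<n x)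

module Forced {n} (G : BipGraph n) (diagonal : ∀ i → G i i ≡ true)
  (s : Fin n → Bool) (forced : DiagonalForcedBy G s) where

  p : Fin n → Bool
  p = not ∘ s

  AllowedMove : Fin n → Fin n → Set
  AllowedMove x y = y ≡ x ⊎ (p x ≡ true × G x y ≡ true)

  stay : ∀ x → AllowedMove x x
  stay x = inj₁ refl

  allowed-permutation-is-id : (τ : Permutation′ n) → (∀ x → AllowedMove x (τ ⟨$⟩ʳ x)) → ∀ x → τ ⟨$⟩ʳ x ≡ x
  allowed-permutation-is-id τ steps = forced τ edge fixes
    where
    edge : ∀ x → G x (τ ⟨$⟩ʳ x) ≡ true
    edge x with steps x
    ... | inj₁ τx≡x = subst (λ y → G x y ≡ true) (sym τx≡x) (diagonal x)
    ... | inj₂ (_ , e) = e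
    fixes : ∀ x → s x ≡ true → τ ⟨$⟩ʳ x ≡ x
    fixes x sx with steps x
    ... | inj₁ τx≡x = τx≡x
    ... | inj₂ (px , _) = contradiction (trans (sym (cong not sx)) px) λ ()

  no-2-cycle : ∀ {i j} → i ≢ j → p i ≡ true → p j ≡ true → G i j ≡ true → G j i ≡ true → ⊥
  no-2-cycle {i} {j} i≢j pi pj Gij Gji =
    i≢j (sym (sym (transpose-i i j) ⟨ trans ⟩ allowed-permutation-is-id (Perm.transpose i j) steps i))
    where
    steps : ∀ x → AllowedMove x (PC.transpose i j x)
    steps x = by-cases (x ≟ i) (x ≟ j)
      where
      by-cases : Dec (x ≡ i) → Dec (x ≡ j) → AllowedMove x (PC.transpose i j x)
      by-cases (yes refl) _ = subst (AllowedMove x) (sym (transpose-i i j)) (inj₂ (pi , Gij))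
      by-cases (no _) (yes refl) = subst (AllowedMove x) (sym (transpose-j i j)) (inj₂ (pj , Gji))
      by-cases (no x≢i) (no x≢j) = subst (AllowedMove x) (sym (transpose-other i j x≢i x≢j)) (stay x)

  no-3-cycle : ∀ {i j l} → i ≢ j → j ≢ l → i ≢ l → p i ≡ true → p j ≡ true → p l ≡ true →
    G i j ≡ true → G j l ≡ true → G l i ≡ true → ⊥
  no-3-cycle {i} {j} {l} i≢j j≢l i≢l pi pj pl Gij Gjl Gli =
    i≢j (sym (sym τi ⟨ trans ⟩ allowed-permutation-is-id (Perm.transpose j l ∘ₚ Perm.transpose i j) steps i))
    where
    τ : Fin n → Fin n
    τ x = PC.transpose i j (PC.transpose j l x)
    τi : τ i ≡ j
    τi = cong (PC.transpose i j) (transpose-other j l i≢j i≢l) ⟨ trans ⟩ transpose-i i j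
    τj : τ j ≡ l
    τj = cong (PC.transpose i j) (transpose-i j l) ⟨ trans ⟩ transpose-other i j (i≢l ∘ sym) (j≢l ∘ sym)
    τl : τ l ≡ i
    τl = cong (PC.transpose i j) (transpose-j j l) ⟨ trans ⟩ transpose-j i j
    steps : ∀ x → AllowedMove x (τ x)
    steps x = by-cases (x ≟ i) (x ≟ j) (x ≟ l)
      where
      by-cases : Dec (x ≡ i) → Dec (x ≡ j) → Dec (x ≡ l) → AllowedMove x (τ x)
      by-cases (yes refl) _ _ = subst (AllowedMove x) (sym τi) (inj₂ (pi , Gij))
      by-cases (no _) (yes refl) _ = subst (AllowedMove x) (sym τj) (inj₂ (pj , Gjl))
      by-cases (no _) (no _) (yes refl) = subst (AllowedMove x) (sym τl) (inj₂ (pl , Gli))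
      by-cases (no x≢i) (no x≢j) (no x≢l) =
        subst (AllowedMove x) (sym (cong (PC.transpose i j) (transpose-other j l x≢j x≢l) ⟨ trans ⟩ transpose-other i j x≢i x≢j))
          (stay x)

  pairWeight≤2 : ∀ x y → pairWeight G p x y ≤ 2
  pairWeight≤2 x y with x ≟ y
  ... | yes refl rewrite ∧-zeroʳ (p x) | ∧-zeroʳ (p x) = +-mono-≤ (+-mono-≤ (⟦⟧≤1 (G x x)) (⟦⟧≤1 (G x x))) z≤n
  ... | no x≢y with p x in px | p y in py
  ...   | false | _ = +-mono-≤ (+-mono-≤ (⟦⟧≤1 (G x y)) (⟦⟧≤1 (G y x))) z≤n
  ...   | true | false = +-mono-≤ (+-mono-≤ (⟦⟧≤1 (G x y)) (⟦⟧≤1 (G y x))) z≤n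
  ...   | true | true with G x y in Gxy | G y x in Gyx
  ...     | true | true = contradiction (no-2-cycle x≢y px py Gxy Gyx) λ ()
  ...     | true | false = ≤-refl
  ...     | false | true = ≤-refl
  ...     | false | false = s≤s z≤n

  edge-bound : e G + e G + distinctPairs p ≤ n * (n * 2)
  edge-bound = subst₂ _≤_ (sum-pairWeight G p) (trans (sum-cong-≗ {n} λ _ → sum-const n 2) (sum-const n (n * 2)))
    (sum-mono-≤ λ x → sum-mono-≤ (pairWeight≤2 x))

  module Tight (tight : ∀ x y → pairWeight G p x y ≡ 2) where

    private
      weight-third-false : ∀ a b c → c ≡ false → ⟦ a ⟧ + ⟦ b ⟧ + ⟦ c ⟧ ≡ 2 → a ≡ true
      weight-third-false true _ _ _ _ = refl
      weight-third-false false true false refl ()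
      weight-third-false false false false refl ()

      weight-first-false : ∀ a b c → a ≡ false → ⟦ a ⟧ + ⟦ b ⟧ + ⟦ c ⟧ ≡ 2 → b ≡ true
      weight-first-false false true _ refl _ = refl
      weight-first-false false false true refl ()
      weight-first-false false false false refl ()

    row-full : ∀ {x} y → s x ≡ true → G x y ≡ true
    row-full {x} y sx = weight-third-false _ _ _ (cong (λ b → not b ∧ (p y ∧ _)) sx) (tight x y)

    column-full : ∀ x {y} → s y ≡ true → G x y ≡ true
    column-full x {y} sy = weight-third-false _ _ _ (cong (λ b → p x ∧ (not b ∧ _)) sy ⟨ trans ⟩ ∧-zeroʳ (p x)) (tight x y)

    tournament : ∀ {x y} → x ≢ y → p x ≡ true → p y ≡ true → G x y ≡ false → G y x ≡ true
    tournament {x} {y} x≢y px py Gxy = weight-first-false _ _ _ Gxy (tight x y)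

    nonedge-trans : ∀ {x y z} → p x ≡ true → p y ≡ true → p z ≡ true → G x y ≡ false → G y z ≡ false → G x z ≡ false
    nonedge-trans {x} {y} {z} px py pz Gxy Gyz with G x z in Gxz
    ... | false = refl
    ... | true = contradiction (no-3-cycle x≢z (y≢z ∘ sym) x≢y px pz py Gxz Gzy Gyx) λ ()
      where
      nonloop : ∀ {a b} → G a b ≡ false → a ≢ b
      nonloop {a} Gab refl = contradiction (trans (sym Gab) (diagonal a)) λ ()
      x≢y = nonloop Gxy
      y≢z = nonloop Gyz
      Gyx = tournament x≢y px py Gxy
      Gzy = tournament y≢z py pz Gyz
      x≢z : x ≢ z
      x≢z refl = contradiction (trans (sym Gxy) Gzy) λ ()

    -- Vertices outside s come first, ordered by non-adjacency; vertices in s follow, by index.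
    _≺_ : Fin n → Fin n → Bool
    x ≺ y = if p y then p x ∧ not (G x y) else (p x ∨ (toℕ x <ᵇ toℕ y))

    ≺-irrefl : ∀ x → (x ≺ x) ≡ false
    ≺-irrefl x with p x
    ... | true rewrite diagonal x = refl
    ... | false = <ᵇ-false (≤-refl {toℕ x})

    ≺-trans : ∀ {x y z} → (x ≺ y) ≡ true → (y ≺ z) ≡ true → (x ≺ z) ≡ true
    ≺-trans {x} {y} {z} x≺y y≺z with p z in pz | p y in py | p x in px
    ... | true | true | true = cong not (nonedge-trans px py pz (not-true x≺y) (not-true y≺z))
      where
      not-true : ∀ {b} → not b ≡ true → b ≡ false
      not-true {false} _ = refl
    ... | false | _ | true = refl
    ... | false | false | false = <ᵇ-true (<-trans (<ᵇ-true⁻¹ {toℕ x} {toℕ y} x≺y) (<ᵇ-true⁻¹ {toℕ y} {toℕ z} y≺z))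

    ≺-connex : ∀ {x y} → x ≢ y → (x ≺ y) ≡ false → (y ≺ x) ≡ true
    ≺-connex {x} {y} x≢y x⊀y with p y in py | p x in px
    ... | true | false = refl
    ... | false | false = <ᵇ-true (≤∧≢⇒< (<ᵇ-false⁻¹ {toℕ x} x⊀y) (x≢y ∘ Fin.toℕ-injective ∘ sym))
    ... | true | true with G y x in Gyx
    ...   | false = refl
    ...   | true = contradiction (no-2-cycle x≢y px py (not-false x⊀y) Gyx) λ ()
      where
      not-false : ∀ {b} → not b ≡ false → b ≡ true
      not-false {true} _ = refl

    open Ranking _≺_ ≺-irrefl ≺-trans ≺-connex

    rank<count : ∀ {y} → p y ≡ true → rank y < count p
    rank<count {y} py = sum-mono-< before-y-in-p y (subst₂ (λ a b → ⟦ a ⟧ < ⟦ b ⟧) (sym (≺-irrefl y)) (sym py) (s≤s z≤n))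
      where
      before-y-in-p : ∀ z → ⟦ z ≺ y ⟧ ≤ ⟦ p z ⟧
      before-y-in-p z rewrite py with p z
      ... | true = ⟦⟧≤1 _
      ... | false = z≤n

    count≤rank : ∀ {y} → p y ≡ false → count p ≤ rank y
    count≤rank {y} py = sum-mono-≤ p-before-y
      where
      p-before-y : ∀ z → ⟦ p z ⟧ ≤ ⟦ z ≺ y ⟧
      p-before-y z rewrite py with p z
      ... | true = ≤-refl
      ... | false = z≤n

    rank-<ᵇ-count : ∀ y → (rank y <ᵇ count p) ≡ p y
    rank-<ᵇ-count y = by-cases (p y) refl
      where
      by-cases : ∀ b → p y ≡ b → (rank y <ᵇ count p) ≡ b
      by-cases true py = <ᵇ-true (rank<count py)
      by-cases false py = <ᵇ-false (count≤rank py)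

    adjacency-by-order : ∀ x y → G x y ≡ not ((x ≺ y) ∧ p y)
    adjacency-by-order x y = by-cases (s y) refl (s x) refl
      where
      by-cases : ∀ b → s y ≡ b → ∀ c → s x ≡ c → G x y ≡ not ((x ≺ y) ∧ p y)
      by-cases true sy _ _ rewrite sy = column-full x sy ⟨ trans ⟩ cong not (sym (∧-zeroʳ _))
      by-cases false sy true sx rewrite sy | sx = row-full y sx
      by-cases false sy false sx rewrite sy | sx with G x y
      ... | true = refl
      ... | false = refl

    tight-≃-H : G ≃ H n (count s)
    tight-≃-H = mk≃ rankPermutation rankPermutation λ x y → adjacency-by-order x y ⟨ trans ⟩ cong₂ (λ a b → not (a ∧ b))
      (sym (rank-<ᵇ x y) ⟨ trans ⟩ cong₂ _<ᵇ_ (sym (toℕ-rankPermutation x)) (sym (toℕ-rankPermutation y)))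
      (sym (rank-<ᵇ-count y) ⟨ trans ⟩ cong₂ _<ᵇ_ (sym (toℕ-rankPermutation y)) (sym n∸count-s))
      where
      n∸count-s : n ∸ count s ≡ count p
      n∸count-s = cong (_∸ count s) (sym (count-complement s)) ⟨ trans ⟩ m+n∸m≡n (count s) (count p)

reflectBelow : ℕ → ℕ → ℕ
reflectBelow t a = if a <ᵇ t then pred t ∸ a else a

module _ {t : ℕ} where

  reflectBelow-< : ∀ {a} → a < t → reflectBelow t a ≡ pred t ∸ a
  reflectBelow-< a<t rewrite <ᵇ-true a<t = refl

  reflectBelow-≥ : ∀ {a} → t ≤ a → reflectBelow t a ≡ a
  reflectBelow-≥ t≤a rewrite <ᵇ-false t≤a = refl

  reflectBelow<t : ∀ {a} → a < t → reflectBelow t a < t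
  reflectBelow<t {a} a<t = subst (_< t) (sym (reflectBelow-< a<t)) (≤-<-trans (m∸n≤m (pred t) a) (pred<self a<t))

  reflectBelow-involutive : ∀ a → reflectBelow t (reflectBelow t a) ≡ a
  reflectBelow-involutive a with a <? t
  ... | yes a<t = reflectBelow-< (reflectBelow<t a<t) ⟨ trans ⟩ cong (pred t ∸_) (reflectBelow-< a<t)
                  ⟨ trans ⟩ m∸[m∸n]≡n (<⇒≤pred a<t)
  ... | no a≮t = cong (reflectBelow t) (reflectBelow-≥ (≮⇒≥ a≮t)) ⟨ trans ⟩ reflectBelow-≥ (≮⇒≥ a≮t)

  reflectBelow-<ᵇ-t : ∀ a → (reflectBelow t a <ᵇ t) ≡ (a <ᵇ t)
  reflectBelow-<ᵇ-t a with a <? t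
  ... | yes a<t = <ᵇ-true (reflectBelow<t a<t) ⟨ trans ⟩ sym (<ᵇ-true a<t)
  ... | no a≮t = cong (_<ᵇ t) (reflectBelow-≥ (≮⇒≥ a≮t))

  reflectBelow-antitone : ∀ {a b} → a < t → b < t → (reflectBelow t b <ᵇ reflectBelow t a) ≡ (a <ᵇ b)
  reflectBelow-antitone {a} {b} a<t b<t rewrite reflectBelow-< a<t | reflectBelow-< b<t with a <? b
  ... | yes a<b = <ᵇ-true (∸-monoʳ-< a<b (<⇒≤pred b<t)) ⟨ trans ⟩ sym (<ᵇ-true a<b)
  ... | no a≮b = <ᵇ-false (∸-monoʳ-≤ (pred t) (≮⇒≥ a≮b)) ⟨ trans ⟩ sym (<ᵇ-false (≮⇒≥ a≮b))

  reflectBelow-chain : ∀ a b → ((a <ᵇ b) ∧ (b <ᵇ t)) ≡ ((reflectBelow t b <ᵇ reflectBelow t a) ∧ (reflectBelow t a <ᵇ t))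
  reflectBelow-chain a b with b <? t | a <? t
  ... | yes b<t | yes a<t =
    cong₂ _∧_ (sym (reflectBelow-antitone a<t b<t)) (<ᵇ-true b<t ⟨ trans ⟩ sym (<ᵇ-true (reflectBelow<t a<t)))
  ... | yes b<t | no a≮t =
    cong (_∧ (b <ᵇ t)) (<ᵇ-false (≤-trans (<⇒≤ b<t) (≮⇒≥ a≮t)))
    ⟨ trans ⟩ sym (cong ((reflectBelow t b <ᵇ reflectBelow t a) ∧_) (reflectBelow-<ᵇ-t a ⟨ trans ⟩ <ᵇ-false (≮⇒≥ a≮t))
      ⟨ trans ⟩ ∧-zeroʳ (reflectBelow t b <ᵇ reflectBelow t a))
  ... | no b≮t | a<?t =
    cong ((a <ᵇ b) ∧_) (<ᵇ-false (≮⇒≥ b≮t)) ⟨ trans ⟩ ∧-zeroʳ (a <ᵇ b)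
    ⟨ trans ⟩ sym (cong (λ c → (c <ᵇ reflectBelow t a) ∧ (reflectBelow t a <ᵇ t)) (reflectBelow-≥ (≮⇒≥ b≮t))
                   ⟨ trans ⟩ b-after-r[a] a<?t)
    where
    b-after-r[a] : _ → ((b <ᵇ reflectBelow t a) ∧ (reflectBelow t a <ᵇ t)) ≡ false
    b-after-r[a] (yes a<t) = cong (_∧ (reflectBelow t a <ᵇ t)) (<ᵇ-false (≤-trans (<⇒≤ (reflectBelow<t a<t)) (≮⇒≥ b≮t)))
    b-after-r[a] (no a≮t) =
      cong ((b <ᵇ reflectBelow t a) ∧_) (reflectBelow-<ᵇ-t a ⟨ trans ⟩ <ᵇ-false (≮⇒≥ a≮t))
      ⟨ trans ⟩ ∧-zeroʳ (b <ᵇ reflectBelow t a)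

  reflectBelow-bounded : ∀ {n a} → t ≤ n → a < n → reflectBelow t a < n
  reflectBelow-bounded {a = a} t≤n a<n with a <? t
  ... | yes a<t = <-≤-trans (reflectBelow<t a<t) t≤n
  ... | no a≮t = subst (_< _) (sym (reflectBelow-≥ (≮⇒≥ a≮t))) a<n

reflectPrefix : ∀ n k → Permutation′ n
reflectPrefix n k = Perm.permutation r r involutive involutive
  where
  r : Fin n → Fin n
  r a = fromℕ< (reflectBelow-bounded (m∸n≤m n k) (Fin.toℕ<n a))
  involutive : ∀ a → r (r a) ≡ a
  involutive a = Fin.toℕ-injective
    (Fin.toℕ-fromℕ< _ ⟨ trans ⟩ cong (reflectBelow (n ∸ k)) (Fin.toℕ-fromℕ< _)
     ⟨ trans ⟩ reflectBelow-involutive {n ∸ k} (toℕ a))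

H-transpose : ∀ n k a b → H n k a b ≡ H n k (reflectPrefix n k ⟨$⟩ʳ b) (reflectPrefix n k ⟨$⟩ʳ a)
H-transpose n k a b = cong not (reflectBelow-chain {n ∸ k} (toℕ a) (toℕ b)
  ⟨ trans ⟩ sym (cong₂ (λ x y → (x <ᵇ y) ∧ (y <ᵇ n ∸ k)) (Fin.toℕ-fromℕ< _) (Fin.toℕ-fromℕ< _)))

Hᵀ≃H : ∀ n k → H n k ᵀ ≃ H n k
Hᵀ≃H n k = mk≃ (reflectPrefix n k) (reflectPrefix n k) λ i j → H-transpose n k j i

module _ (n k : ℕ) where

  inPrefix : Fin n → Bool
  inPrefix a = toℕ a <ᵇ n ∸ k

  H-diagonal : ∀ a → H n k a a ≡ true
  H-diagonal a rewrite <ᵇ-false (≤-refl {toℕ a}) = refl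

  H-pairWeight : ∀ a b → pairWeight (H n k) inPrefix a b ≡ 2
  H-pairWeight a b with a ≟ b
  ... | yes refl rewrite <ᵇ-false (≤-refl {toℕ a}) | ∧-zeroʳ (inPrefix a) | ∧-zeroʳ (inPrefix a) = refl
  ... | no a≢b with <-cmp (toℕ a) (toℕ b)
  ...   | tri≈ _ a≡b _ = contradiction (Fin.toℕ-injective a≡b) a≢b
  ...   | tri< a<b _ _ rewrite <ᵇ-true a<b | <ᵇ-false (<⇒≤ a<b) with inPrefix b in b∈
  ...     | true rewrite <ᵇ-true {toℕ a} {n ∸ k} (<-trans a<b (<ᵇ-true⁻¹ b∈)) = refl
  ...     | false rewrite ∧-zeroʳ (inPrefix a) = refl
  H-pairWeight a b | no a≢b | tri> _ _ b<a rewrite <ᵇ-true b<a | <ᵇ-false (<⇒≤ b<a) with inPrefix a in a∈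
  ...     | true rewrite <ᵇ-true {toℕ b} {n ∸ k} (<-trans b<a (<ᵇ-true⁻¹ a∈)) = refl
  ...     | false = refl

  H-edges : e (H n k) + e (H n k) + distinctPairs inPrefix ≡ n * (n * 2)
  H-edges = sym (sum-pairWeight (H n k) inPrefix)
    ⟨ trans ⟩ sum-cong-≗ (λ a → sum-cong-≗ (H-pairWeight a))
    ⟨ trans ⟩ sum-cong-≗ {n} (λ _ → sum-const n 2) ⟨ trans ⟩ sum-const n (n * 2)

  H-perfectMatching-unique : (h : Fin n → Fin n) → Injective _≡_ _≡_ h → (∀ a → H n k a (h a) ≡ true) →
    (∀ a → inPrefix a ≡ false → h a ≡ a) → ∀ a → h a ≡ a
  H-perfectMatching-unique h h-inj h-edge h-fixes a = fixed-below (suc (toℕ a)) a ≤-refl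
    where
    -- If h a < a then h (h a) = h a by induction, so h a = a; if h a > a then either
    -- h a is outside the prefix and fixed, or u_a v_(h a) is not an edge.
    fixed-below : ∀ N a → toℕ a < N → h a ≡ a
    fixed-below (suc N) a (s≤s a≤N) with <-cmp (toℕ (h a)) (toℕ a)
    ... | tri< ha<a _ _ = h-inj (fixed-below N (h a) (≤-trans ha<a a≤N))
    ... | tri≈ _ ha≡a _ = Fin.toℕ-injective ha≡a
    ... | tri> _ _ a<ha with inPrefix (h a) in ha∈
    ...   | false = h-inj (h-fixes (h a) ha∈)
    ...   | true = contradiction (sym non-edge ⟨ trans ⟩ h-edge a) λ ()
      where
      non-edge : H n k a (h a) ≡ false
      non-edge = cong₂ (λ x y → not (x ∧ y)) (<ᵇ-true a<ha) ha∈

  H-forcingSet : k ≤ n → HasForcingSetOfSize (H n k) k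
  H-forcingSet k≤n = (id , id , H-diagonal) , S , S-forces , ∣S∣≡k
    where
    S : Subset n
    S = Vec.tabulate (not ∘ inPrefix)
    ∣S∣≡k : ∣ S ∣ ≡ k
    ∣S∣≡k = ∣∣≡count S ⟨ trans ⟩ sum-cong-≗ (λ a → cong ⟦_⟧ (Vec.lookup∘tabulate (not ∘ inPrefix) a))
      ⟨ trans ⟩ +-cancelˡ-≡ (n ∸ k) _ k (cong (_+ count (not ∘ inPrefix)) (sym (count-<ᵇ (n ∸ k) (m∸n≤m n k)))
        ⟨ trans ⟩ count-complement inPrefix ⟨ trans ⟩ sym (m∸n+n≡m k≤n))
    S-forces : IsForcingSet (H n k) (id , id , H-diagonal) S
    S-forces (h , h-inj , h-edge) agree = H-perfectMatching-unique h h-inj h-edge λ a a∉prefix →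
      agree a (Vec.lookup⇒[]= a S (Vec.lookup∘tabulate (not ∘ inPrefix) a ⟨ trans ⟩ cong not a∉prefix))

Adj-sym : ∀ {n} (G : BipGraph n) u w → Adj G u w ≡ Adj G w u
Adj-sym G (inj₁ _) (inj₁ _) = refl
Adj-sym G (inj₁ _) (inj₂ _) = refl
Adj-sym G (inj₂ _) (inj₁ _) = refl
Adj-sym G (inj₂ _) (inj₂ _) = refl

sameSide otherSide : ∀ {n} → Vtx n → Fin n → Vtx n
sameSide (inj₁ _) = inj₁
sameSide (inj₂ _) = inj₂
otherSide (inj₁ _) = inj₂
otherSide (inj₂ _) = inj₁

otherSide-otherSide : ∀ {n} (w : Vtx n) x y → otherSide (otherSide w x) y ≡ sameSide w y
otherSide-otherSide (inj₁ _) _ _ = refl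
otherSide-otherSide (inj₂ _) _ _ = refl

Adj-otherSide : ∀ {n} (G : BipGraph n) {u} w → Adj G u w ≡ true → Σ (Fin n) λ x → u ≡ otherSide w x
Adj-otherSide G {inj₁ i} (inj₂ _) _ = i , refl
Adj-otherSide G {inj₂ j} (inj₁ _) _ = j , refl

module _ {n} (χ : Vtx n → Vtx n) (χ-injective : ∀ {u v} → χ u ≡ χ v → u ≡ v) where

  restrictToSide : (c d : Fin n → Vtx n) → Injective _≡_ _≡_ c → (∀ a → Σ (Fin n) λ x → χ (c a) ≡ d x) →
    Σ (Permutation′ n) λ π → ∀ a → χ (c a) ≡ d (π ⟨$⟩ʳ a)
  restrictToSide c d c-inj lands = injective⇒permutation π π-inj , proj₂ ∘ lands
    where
    π : Fin n → Fin n
    π = proj₁ ∘ lands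
    π-inj : Injective _≡_ _≡_ π
    π-inj {a} {a′} πa≡πa′ = c-inj (χ-injective (proj₂ (lands a) ⟨ trans ⟩ cong d πa≡πa′ ⟨ trans ⟩ sym (proj₂ (lands a′))))

-- In H n k the vertex v₀ sees all of U and u_top sees all of V, so an isomorphism maps
-- each side of H n k onto one side of G; if it exchanges the sides, use Hᵀ ≃ H.
≅H⇒≃ : ∀ {n k} {G : BipGraph n} → k < n → G ≅ H n k → G ≃ H n k
≅H⇒≃ {n} {k} {G} k<n (φ , φ-adj) = by-side (χ (inj₂ v₀)) H≃sides
  where
  χ : Vtx n → Vtx n
  χ = Inverse.from φ
  χ-injective : ∀ {u v} → χ u ≡ χ v → u ≡ v
  χ-injective {u} {v} χu≡χv =
    sym (Inverse.strictlyInverseˡ φ u) ⟨ trans ⟩ cong (Inverse.to φ) χu≡χv ⟨ trans ⟩ Inverse.strictlyInverseˡ φ v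
  χ-adj : ∀ u v → Adj (H n k) u v ≡ Adj G (χ u) (χ v)
  χ-adj u v = cong₂ (Adj (H n k)) (sym (Inverse.strictlyInverseˡ φ u)) (sym (Inverse.strictlyInverseˡ φ v))
    ⟨ trans ⟩ sym (φ-adj (χ u) (χ v))
  0<n : 0 < n
  0<n = <-≤-trans (s≤s z≤n) k<n
  v₀ top : Fin n
  v₀ = fromℕ< 0<n
  top = fromℕ< (pred<self 0<n)
  H-v₀ : ∀ a → H n k a v₀ ≡ true
  H-v₀ a rewrite Fin.toℕ-fromℕ< 0<n = refl
  H-top : ∀ b → H n k top b ≡ true
  H-top b = cong (λ c → not (c ∧ (toℕ b <ᵇ n ∸ k)))
    (<ᵇ-false {toℕ top} {toℕ b} (subst (toℕ b ≤_) (sym (Fin.toℕ-fromℕ< _)) (pred-mono-≤ (Fin.toℕ<n b))))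
  w = χ (inj₂ v₀)
  π-data = restrictToSide χ χ-injective inj₁ (otherSide w) inj₁-injective λ a →
    Adj-otherSide G w (sym (χ-adj (inj₁ a) (inj₂ v₀)) ⟨ trans ⟩ H-v₀ a)
  π = proj₁ π-data
  ρ-data = restrictToSide χ χ-injective inj₂ (sameSide w) inj₂-injective λ b →
    let y , χb≡ = Adj-otherSide G (χ (inj₁ top))
                    (Adj-sym G _ (χ (inj₁ top)) ⟨ trans ⟩ sym (χ-adj (inj₁ top) (inj₂ b)) ⟨ trans ⟩ H-top b)
    in y , (χb≡ ⟨ trans ⟩ cong (λ u → otherSide u y) (proj₂ π-data top) ⟨ trans ⟩ otherSide-otherSide w (π ⟨$⟩ʳ top) y)
  ρ = proj₁ ρ-data
  H≃sides : H n k ≃ (λ i j → Adj G (otherSide w i) (sameSide w j))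
  H≃sides = mk≃ π ρ λ a b → χ-adj (inj₁ a) (inj₂ b) ⟨ trans ⟩ cong₂ (Adj G) (proj₂ π-data a) (proj₂ ρ-data b)
  by-side : ∀ w → H n k ≃ (λ i j → Adj G (otherSide w i) (sameSide w j)) → G ≃ H n k
  by-side (inj₂ _) H≃G = ≃-sym H≃G
  by-side (inj₁ _) H≃Gᵀ = ≃-trans (≃-transpose (≃-sym H≃Gᵀ)) (Hᵀ≃H n k)

module Discriminant where

  open import Data.Integer as ℤ using (ℤ; +_; +≤+; -[1+_])
  import Data.Integer.Properties as ℤ
  open import Data.Integer.Tactic.RingSolver using (solve-∀)

  lhsScaled-≡ : ∀ {n f t} → f + t ≡ n → lhsScaled n f ≡ + (2 * t) ℤ.- + 1
  lhsScaled-≡ {f = f} {t} refl = begin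
    + (2 * (f + t)) ℤ.- + 1 ℤ.- + (2 * f)
      ≡⟨ cong₂ (λ a b → a ℤ.- + 1 ℤ.- b) (ℤ.pos-* 2 (f + t) ⟨ trans ⟩ cong (+ 2 ℤ.*_) (ℤ.pos-+ f t)) (ℤ.pos-* 2 f) ⟩
    + 2 ℤ.* (+ f ℤ.+ + t) ℤ.- + 1 ℤ.- + 2 ℤ.* + f    ≡⟨ simplify (+ f) (+ t) ⟩
    + 2 ℤ.* + t ℤ.- + 1                              ≡⟨ cong (ℤ._- + 1) (ℤ.pos-* 2 t) ⟨
    + (2 * t) ℤ.- + 1                                ∎
    where
    open ≡-Reasoning
    simplify : ∀ φ τ → + 2 ℤ.* (φ ℤ.+ τ) ℤ.- + 1 ℤ.- + 2 ℤ.* φ ≡ + 2 ℤ.* τ ℤ.- + 1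
    simplify = solve-∀

  discScaled-≡ : ∀ {n t E D R} → D + t ≡ t * t → E + E + D + R ≡ n * (n * 2) →
    discScaled n E ≡ (+ (2 * t) ℤ.- + 1) ℤ.* (+ (2 * t) ℤ.- + 1) ℤ.+ + (4 * R)
  discScaled-≡ {n} {t} {E} {D} {R} D+t≡t² total = begin
    discScaled n E
      ≡⟨ cast-disc ⟩
    + 8 ℤ.* (+ n ℤ.* + n) ℤ.- + 8 ℤ.* + E ℤ.+ + 1
      ≡⟨ expand (+ n) (+ t) (+ E) (+ D) (+ R) ⟩
    L ℤ.* L ℤ.+ + 4 ℤ.* + R ℤ.+ + 4 ℤ.* (+ D ℤ.+ + t ℤ.- + t ℤ.* + t)
      ℤ.- + 4 ℤ.* (+ E ℤ.+ + E ℤ.+ + D ℤ.+ + R ℤ.- + n ℤ.* (+ n ℤ.* + 2))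
      ≡⟨ cong₂ (λ a b → L ℤ.* L ℤ.+ + 4 ℤ.* + R ℤ.+ + 4 ℤ.* (a ℤ.- + t ℤ.* + t) ℤ.- + 4 ℤ.* (b ℤ.- + n ℤ.* (+ n ℤ.* + 2)))
               cast-D cast-total ⟩
    L ℤ.* L ℤ.+ + 4 ℤ.* + R ℤ.+ + 4 ℤ.* (+ t ℤ.* + t ℤ.- + t ℤ.* + t)
      ℤ.- + 4 ℤ.* (+ n ℤ.* (+ n ℤ.* + 2) ℤ.- + n ℤ.* (+ n ℤ.* + 2))
      ≡⟨ cancel L (+ R) (+ t ℤ.* + t) (+ n ℤ.* (+ n ℤ.* + 2)) ⟩
    L ℤ.* L ℤ.+ + 4 ℤ.* + R
      ≡⟨ cong₂ (λ a b → a ℤ.* a ℤ.+ b) (cong (ℤ._- + 1) (sym (ℤ.pos-* 2 t))) (sym (ℤ.pos-* 4 R)) ⟩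
    (+ (2 * t) ℤ.- + 1) ℤ.* (+ (2 * t) ℤ.- + 1) ℤ.+ + (4 * R)
      ∎
    where
    open ≡-Reasoning
    L = + 2 ℤ.* + t ℤ.- + 1
    expand : ∀ ν τ ε δ ρ → + 8 ℤ.* (ν ℤ.* ν) ℤ.- + 8 ℤ.* ε ℤ.+ + 1 ≡
      (+ 2 ℤ.* τ ℤ.- + 1) ℤ.* (+ 2 ℤ.* τ ℤ.- + 1) ℤ.+ + 4 ℤ.* ρ ℤ.+ + 4 ℤ.* (δ ℤ.+ τ ℤ.- τ ℤ.* τ)
        ℤ.- + 4 ℤ.* (ε ℤ.+ ε ℤ.+ δ ℤ.+ ρ ℤ.- ν ℤ.* (ν ℤ.* + 2))
    expand = solve-∀
    cancel : ∀ l ρ a b → l ℤ.* l ℤ.+ + 4 ℤ.* ρ ℤ.+ + 4 ℤ.* (a ℤ.- a) ℤ.- + 4 ℤ.* (b ℤ.- b) ≡ l ℤ.* l ℤ.+ + 4 ℤ.* ρ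
    cancel = solve-∀
    cast-disc : discScaled n E ≡ + 8 ℤ.* (+ n ℤ.* + n) ℤ.- + 8 ℤ.* + E ℤ.+ + 1
    cast-disc = cong₂ (λ a b → a ℤ.- b ℤ.+ + 1) (ℤ.pos-* 8 (n * n) ⟨ trans ⟩ cong (+ 8 ℤ.*_) (ℤ.pos-* n n)) (ℤ.pos-* 8 E)
    cast-D : + D ℤ.+ + t ≡ + t ℤ.* + t
    cast-D = sym (ℤ.pos-+ D t) ⟨ trans ⟩ cong +_ D+t≡t² ⟨ trans ⟩ ℤ.pos-* t t
    cast-total : + E ℤ.+ + E ℤ.+ + D ℤ.+ + R ≡ + n ℤ.* (+ n ℤ.* + 2)
    cast-total =
      sym (ℤ.pos-+ (E + E + D) R ⟨ trans ⟩ cong (ℤ._+ + R) (ℤ.pos-+ (E + E) D ⟨ trans ⟩ cong (ℤ._+ + D) (ℤ.pos-+ E E)))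
      ⟨ trans ⟩ cong +_ total ⟨ trans ⟩ ℤ.pos-* n (n * 2) ⟨ trans ⟩ cong (+ n ℤ.*_) (ℤ.pos-* n 2)

  i*i-nonneg : ∀ i → + 0 ℤ.≤ i ℤ.* i
  i*i-nonneg (+ m) = subst (+ 0 ℤ.≤_) (ℤ.pos-* m m) (+≤+ z≤n)
  i*i-nonneg -[1+ m ] = +≤+ z≤n

  ≤√-square+ : ∀ L R → L ≤√ (L ℤ.* L ℤ.+ + R)
  ≤√-square+ L R = ℤ.+-mono-≤ (i*i-nonneg L) (+≤+ z≤n) , inj₂ (ℤ.i≤i+j (L ℤ.* L) (+ R))

  ≡√-square+⇒≡0 : ∀ L R → L ≡√ (L ℤ.* L ℤ.+ + R) → R ≡ 0
  ≡√-square+⇒≡0 L R (_ , L²≡L²+R) =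
    ℤ.+-injective (cancel (L ℤ.* L) (+ R) ⟨ trans ⟩ cong (ℤ._- L ℤ.* L) (sym L²≡L²+R) ⟨ trans ⟩ ℤ.+-inverseʳ (L ℤ.* L))
    where
    cancel : ∀ a r → r ≡ a ℤ.+ r ℤ.- a
    cancel = solve-∀

  ≡√-square+0 : ∀ L → + 0 ℤ.≤ L → L ≡√ (L ℤ.* L ℤ.+ + 0)
  ≡√-square+0 L 0≤L = 0≤L , sym (ℤ.+-identityʳ (L ℤ.* L))

  0≤2t-1⇒0<t : ∀ {t} → + 0 ℤ.≤ + (2 * t) ℤ.- + 1 → 0 < t
  0≤2t-1⇒0<t {zero} ()
  0≤2t-1⇒0<t {suc t} _ = s≤s z≤n

  0<t⇒0≤2t-1 : ∀ {t} → 0 < t → + 0 ℤ.≤ + (2 * t) ℤ.- + 1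
  0<t⇒0≤2t-1 {suc t} _ = +≤+ z≤n

  discriminant-analysis : ∀ {n f t E D R} → f + t ≡ n → D + t ≡ t * t → E + E + D + R ≡ n * (n * 2) →
    (lhsScaled n f ≤√ discScaled n E) × ((lhsScaled n f ≡√ discScaled n E) ⇔ (R ≡ 0 × 0 < t))
  discriminant-analysis {n} {f} {t} {E} {D} {R} f+t≡n D+t≡t² total =
    subst (L ≤√_) (sym disc≡) (≤√-square+ L (4 * R)) , mk⇔ equality⇒ ⇒equality
    where
    L = lhsScaled n f
    L≡ : L ≡ + (2 * t) ℤ.- + 1
    L≡ = lhsScaled-≡ {n} {f} {t} f+t≡n
    disc≡ : discScaled n E ≡ L ℤ.* L ℤ.+ + (4 * R)
    disc≡ = discScaled-≡ {n} {t} {E} {D} {R} D+t≡t² total ⟨ trans ⟩ cong (λ L′ → L′ ℤ.* L′ ℤ.+ + (4 * R)) (sym L≡)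
    equality⇒ : L ≡√ discScaled n E → R ≡ 0 × 0 < t
    equality⇒ L≡√disc = *-cancelˡ-≡ R 0 4 (≡√-square+⇒≡0 L (4 * R) (subst (L ≡√_) disc≡ L≡√disc))
                      , 0≤2t-1⇒0<t (subst (+ 0 ℤ.≤_) L≡ (proj₁ L≡√disc))
    ⇒equality : R ≡ 0 × 0 < t → L ≡√ discScaled n E
    ⇒equality (refl , 0<t) = subst (L ≡√_) (sym disc≡) (≡√-square+0 L (subst (+ 0 ℤ.≤_) (sym L≡) (0<t⇒0≤2t-1 0<t)))

open Discriminant using (discriminant-analysis)

module ForcingAnalysis {n} (G : BipGraph n) (M : PerfectMatching G) (S : Subset n) (S-forces : IsForcingSet G M S) where

  open Forced (matchingFrame G M) (matchingFrame-diagonal G M) (Vec.lookup S) (matchingFrame-forced G M S S-forces)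
    using (p; pairWeight≤2; edge-bound; module Tight) public

  t : ℕ
  t = count p

  ∣S∣+t≡n : ∣ S ∣ + t ≡ n
  ∣S∣+t≡n = cong (_+ t) (∣∣≡count S) ⟨ trans ⟩ count-complement (Vec.lookup S)

  e-frame : e (matchingFrame G M) ≡ e G
  e-frame = sym (≃-edges (≃-matchingFrame G M))

  slack : ℕ
  slack = n * (n * 2) ∸ (e G + e G + distinctPairs p)

  edges+slack : e G + e G + distinctPairs p + slack ≡ n * (n * 2)
  edges+slack = m+[n∸m]≡n (subst (λ E → E + E + distinctPairs p ≤ n * (n * 2)) e-frame edge-bound)

  slack≡0⇒≃H : slack ≡ 0 → G ≃ H n ∣ S ∣
  slack≡0⇒≃H slack≡0 =
    ≃-trans (≃-matchingFrame G M) (subst (λ k → _ ≃ H n k) (sym (∣∣≡count S)) (Tight.tight-≃-H tight))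
    where
    full : n * (n * 2) ≤ e (matchingFrame G M) + e (matchingFrame G M) + distinctPairs p
    full = subst (λ E → n * (n * 2) ≤ E + E + distinctPairs p) (sym e-frame)
      (≤-reflexive (sym edges+slack ⟨ trans ⟩ cong (λ r → e G + e G + distinctPairs p + r) slack≡0 ⟨ trans ⟩ +-identityʳ _))
    tight = pairWeight-tight (matchingFrame G M) p pairWeight≤2 full

  ≃H⇒slack≡0 : ∀ {k} → G ≃ H n k → n ∸ k ≤ t → slack ≡ 0
  ≃H⇒slack≡0 {k} G≃H n∸k≤t = n≤0⇒n≡0 (+-cancelˡ-≤ (e G + e G + distinctPairs p) slack 0 (begin
    e G + e G + distinctPairs p + slack                    ≡⟨ edges+slack ⟩
    n * (n * 2)                                            ≡⟨ H-edges n k ⟨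
    e (H n k) + e (H n k) + distinctPairs (inPrefix n k)   ≤⟨ +-mono-≤ (≤-reflexive (cong (λ E → E + E) eH≡eG)) fewer-pairs ⟩
    e G + e G + distinctPairs p                            ≡⟨ +-identityʳ _ ⟨
    e G + e G + distinctPairs p + 0                        ∎))
    where
    open ≤-Reasoning
    eH≡eG : e (H n k) ≡ e G
    eH≡eG = sym (≃-edges G≃H)
    fewer-pairs : distinctPairs (inPrefix n k) ≤ distinctPairs p
    fewer-pairs = distinctPairs-mono (inPrefix n k) p (subst (_≤ t) (sym (count-<ᵇ (n ∸ k) (m∸n≤m n k))) n∸k≤t)

corollary2p4 : (n : ℕ) (G : BipGraph n) → PerfectMatching G → (f : ℕ) → IsForcingNumber G f →
    (lhsScaled n f ≤√ discScaled n (e G))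
    × ((lhsScaled n f ≡√ discScaled n (e G)) ⇔ (∃[ k ] (k < n × G ≅ H n k)))
corollary2p4 n G _ f ((M , S , S-forces , ∣S∣≡f) , minimal) =
  bound , mk⇔ (tight⇒≅H ∘ Equivalence.to equality⇔tight) (Equivalence.from equality⇔tight ∘ ≅H⇒tight)
  where
  open ForcingAnalysis G M S S-forces
  f+t≡n : f + t ≡ n
  f+t≡n = cong (_+ t) (sym ∣S∣≡f) ⟨ trans ⟩ ∣S∣+t≡n
  analysis = discriminant-analysis {n} {f} {t} {e G} {distinctPairs p} {slack} f+t≡n (distinctPairs+count p) edges+slack
  bound = proj₁ analysis
  equality⇔tight = proj₂ analysis
  tight⇒≅H : slack ≡ 0 × 0 < t → ∃[ k ] (k < n × G ≅ H n k)
  tight⇒≅H (slack≡0 , 0<t) =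
    f , subst (f <_) f+t≡n (m<m+n f 0<t) , ≃⇒≅ (subst (λ k → G ≃ H n k) ∣S∣≡f (slack≡0⇒≃H slack≡0))
  ≅H⇒tight : ∃[ k ] (k < n × G ≅ H n k) → slack ≡ 0 × 0 < t
  ≅H⇒tight (k , k<n , G≅H) = ≃H⇒slack≡0 {k} G≃H n∸k≤t , <-≤-trans (m<n⇒0<n∸m k<n) n∸k≤t
    where
    G≃H : G ≃ H n k
    G≃H = ≅H⇒≃ k<n G≅H
    f≤k : f ≤ k
    f≤k = forcingNumber≤ {G = G} minimal (≃-forcingSet G≃H (H-forcingSet n k (<⇒≤ k<n)))
    n∸k≤t : n ∸ k ≤ t
    n∸k≤t = subst (n ∸ k ≤_) (cong (_∸ f) (sym f+t≡n) ⟨ trans ⟩ m+n∸m≡n f t) (∸-monoʳ-≤ n f≤k)
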